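{- Let $G=(V,E)$ be a connected graph with $n$ vertices and $w$ edges. There is a contractive carving decomposition of $G$ of height $n-1$ and width at most $w$.
   Context: Graphs may have multiple edges but no loops. A rooted carving decomposition of a graph $G=(V,E)$ is a pair $(T,\gamma)$ where $T$ is a rooted binary tree and $\gamma$ is a bijection from the leaves of $T$ to $V$. For a node $u$ of $T$, $V[u]$ is the set of vertices $\gamma(u')$ for leaves $u'$ of the subtree of $T$ rooted at $u$. For $V_1,V_2\subseteq V$, $E(V_1,V_2)$ is the set of edges with one endpoint in $V_1$ and the other in $V_2$. The width of $(T,\gamma)$ is $\max_u|E(V[u],V\setminus V[u])|$ over all nodes $u$; its height is the height of $T$. It is contractive if for every internal node $u$ with children $u.l,u.r$, $E(V[u.l],V[u.r])\neq\emptyset$. -}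

module Defs where

open import Data.Nat using (ℕ; zero; suc; _+_; _⊔_)
open import Data.Fin using (Fin; _≟_)
open import Data.Bool using (Bool; _xor_; _∧_; _∨_)
open import Data.List using (List; []; _∷_; _++_; length; filterᵇ)
open import Data.Bool.ListAction using (any)
open import Data.List.Membership.Propositional using (_∈_)
open import Data.List.Relation.Unary.All using (All)
open import Data.List.Relation.Unary.Any using (Any)
open import Data.List.Relation.Unary.Unique.Propositional using (Unique)
open import Data.Product using (_×_; _,_; proj₁; proj₂)
open import Data.Unit using (⊤)
open import Relation.Binary.PropositionalEquality using (_≢_)
open import Relation.Nullary.Decidable using (⌊_⌋)

-- A (multi)graph on vertex set Fin n: a list of edges (repetitions allowed,
-- giving multiple edges), each edge an unordered pair stored as an ordered
-- pair of distinct endpoints (no loops).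
record Graph (n : ℕ) : Set where
  field
    edges    : List (Fin n × Fin n)
    loopless : All (λ e → proj₁ e ≢ proj₂ e) edges
open Graph public

numEdges : ∀ {n} → Graph n → ℕ
numEdges G = length (edges G)

Adj : ∀ {n} → Graph n → Fin n → Fin n → Set
Adj G u v = ((u , v) ∈ edges G) Data.Sum.⊎ ((v , u) ∈ edges G)
  where import Data.Sum

data Walk {n : ℕ} (G : Graph n) : Fin n → Fin n → Set where
  here : ∀ {u} → Walk G u u
  step : ∀ {u x v} → Adj G u x → Walk G x v → Walk G u v

Connected : ∀ {n} → Graph n → Set
Connected {n} G = (1 Data.Nat.≤ n) × (∀ u v → Walk G u v)
  where import Data.Nat

data Tree (n : ℕ) : Set where
  leaf : Fin n → Tree n
  node : Tree n → Tree n → Tree n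

leaves : ∀ {n} → Tree n → List (Fin n)
leaves (leaf v)   = v ∷ []
leaves (node l r) = leaves l ++ leaves r

height : ∀ {n} → Tree n → ℕ
height (leaf _)   = 0
height (node l r) = suc (height l ⊔ height r)

-- γ is a bijection from the leaves onto V: every vertex labels exactly one leaf
IsCarving : ∀ {n} → Tree n → Set
IsCarving {n} T = (∀ v → v ∈ leaves T) × Unique (leaves T)

_∈ᵇ_ : ∀ {n} → Fin n → List (Fin n) → Bool
v ∈ᵇ S = any (λ x → ⌊ x ≟ v ⌋) S

cut : ∀ {n} → Graph n → List (Fin n) → ℕ
cut G S = length (filterᵇ (λ e → (proj₁ e ∈ᵇ S) xor (proj₂ e ∈ᵇ S)) (edges G))

width : ∀ {n} → Graph n → Tree n → ℕ
width G (leaf v)       = cut G (leaves (leaf v))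
width G t@(node l r)   = cut G (leaves t) ⊔ (width G l ⊔ width G r)

EdgeBetween : ∀ {n} → Graph n → List (Fin n) → List (Fin n) → Set
EdgeBetween G S₁ S₂ =
  Any (λ e → ((proj₁ e ∈ S₁) × (proj₂ e ∈ S₂)) Data.Sum.⊎ ((proj₂ e ∈ S₁) × (proj₁ e ∈ S₂))) (edges G)
  where import Data.Sum

Contractive : ∀ {n} → Graph n → Tree n → Set
Contractive G (leaf _)   = ⊤
Contractive G (node l r) = EdgeBetween G (leaves l) (leaves r) × Contractive G l × Contractive G r

-- Build a caterpillar: starting from a single leaf, repeatedly make the current
-- tree the right child of a new root whose left child is a fresh vertex adjacent
-- to the vertices already placed. Connectivity guarantees such a vertex exists
-- while some vertex is missing (a walk from a missing vertex into the placed set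
-- must cross its boundary), and each new root then has an edge between its two
-- children. After n − 1 steps all n vertices are placed and the height is n − 1;
-- the width bound is trivial, as every cut is a set of edges.
module Submission where

open import Defs
open import Data.Nat using (ℕ; _≤_; _∸_)
open import Data.Product using (Σ; _×_)
open import Relation.Binary.PropositionalEquality using (_≡_)

open import Data.Nat using (zero; suc; _<_)
open import Data.Nat.Properties using (≤-refl; ≤-reflexive; ⊔-lub; <⇒≱; <⇒≤)
open import Data.Fin using (Fin; fromℕ<; _≟_)
open import Data.Fin.Properties using (injective⇒≤; ¬∀⟶∃¬)
open import Data.List using (List; []; _∷_; length; lookup)
open import Data.List.Properties using (length-filter)
open import Data.List.Membership.Propositional.Properties using (∈-lookup; ∈-++⁺ˡ)
open import Data.List.Membership.Propositional using (_∈_; _∉_)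
import Data.List.Membership.Setoid.Properties as Membership
open import Data.List.Relation.Unary.All using (All; []; _∷_) renaming (lookup to All-lookup)
open import Data.List.Relation.Unary.Any as Any using (here)
open import Data.List.Relation.Unary.AllPairs using ([]; _∷_)
open import Data.List.Relation.Unary.Unique.Propositional using (Unique)
open import Data.Product using (_,_; ∃)
open import Data.Sum using (inj₁; inj₂)
open import Data.Unit using (tt)
open import Function.Definitions using (Injective)
open import Relation.Nullary using (Dec; yes; no; contradiction)
open import Relation.Binary.PropositionalEquality using (refl; sym; cong; subst; setoid)

_∈?_ : ∀ {n} (v : Fin n) (xs : List (Fin n)) → Dec (v ∈ xs)
v ∈? xs = Any.any? (v ≟_) xs

lookup-injective : ∀ {A : Set} {xs : List A} → Unique xs → Injective _≡_ _≡_ (lookup xs)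
lookup-injective (_ ∷ _)   {Fin.zero}  {Fin.zero}  _  = refl
lookup-injective (x∉ ∷ _)  {Fin.zero}  {Fin.suc j} eq = contradiction eq (All-lookup x∉ (∈-lookup j))
lookup-injective (x∉ ∷ _)  {Fin.suc i} {Fin.zero}  eq = contradiction (sym eq) (All-lookup x∉ (∈-lookup i))
lookup-injective (_ ∷ xs!) {Fin.suc i} {Fin.suc j} eq = cong Fin.suc (lookup-injective xs! eq)

Unique⇒length≤ : ∀ {n} {xs : List (Fin n)} → Unique xs → length xs ≤ n
Unique⇒length≤ xs! = injective⇒≤ (lookup-injective xs!)

covering⇒length≥ : ∀ {n} {xs : List (Fin n)} → (∀ v → v ∈ xs) → n ≤ length xs
covering⇒length≥ cover = injective⇒≤ {f = λ v → Any.index (cover v)} index-injective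
  where
  index-injective : ∀ {u v} → Any.index (cover u) ≡ Any.index (cover v) → u ≡ v
  index-injective {u} {v} = Membership.index-injective (setoid _) (cover u) (cover v)

length<⇒∃∉ : ∀ {n} {xs : List (Fin n)} → length xs < n → ∃ λ v → v ∉ xs
length<⇒∃∉ {n} {xs} |xs|<n =
  ¬∀⟶∃¬ n (_∈ xs) (_∈? xs) (λ cover → <⇒≱ |xs|<n (covering⇒length≥ cover))

∉∧Unique⇒Unique∷ : ∀ {A : Set} {x : A} {xs} → x ∉ xs → Unique xs → Unique (x ∷ xs)
∉∧Unique⇒Unique∷ x∉xs xs! = Membership.∉⇒All[≉] (setoid _) x∉xs ∷ xs!

Unique∧length≡⇒complete : ∀ {n} {xs : List (Fin n)} → Unique xs → length xs ≡ n →
                          ∀ v → v ∈ xs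
Unique∧length≡⇒complete {xs = xs} xs! |xs|≡n v with v ∈? xs
... | yes v∈xs = v∈xs
... | no  v∉xs = contradiction (Unique⇒length≤ (∉∧Unique⇒Unique∷ v∉xs xs!))
                               (<⇒≱ (≤-reflexive (cong suc (sym |xs|≡n))))

leftmost : ∀ {n} → Tree n → Fin n
leftmost (leaf v)   = v
leftmost (node l _) = leftmost l

leftmost∈leaves : ∀ {n} (T : Tree n) → leftmost T ∈ leaves T
leftmost∈leaves (leaf v)   = here refl
leftmost∈leaves (node l r) = ∈-++⁺ˡ (leftmost∈leaves l)

module _ {n : ℕ} (G : Graph n) where

  Adj⇒EdgeBetween : ∀ {x y} {S : List (Fin n)} → Adj G x y → y ∈ S → EdgeBetween G (x ∷ []) S
  Adj⇒EdgeBetween (inj₁ xy∈E) y∈S = Any.map (λ { refl → inj₁ (here refl , y∈S) }) xy∈E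
  Adj⇒EdgeBetween (inj₂ yx∈E) y∈S = Any.map (λ { refl → inj₂ (here refl , y∈S) }) yx∈E

  Walk⇒boundaryVertex : ∀ {a b} {S : List (Fin n)} → Walk G a b → a ∉ S → b ∈ S →
                        ∃ λ x → x ∉ S × EdgeBetween G (x ∷ []) S
  Walk⇒boundaryVertex here a∉S b∈S = contradiction b∈S a∉S
  Walk⇒boundaryVertex {a} {S = S} (step {x = x} ax w) a∉S b∈S with x ∈? S
  ... | yes x∈S = a , a∉S , Adj⇒EdgeBetween ax x∈S
  ... | no  x∉S = Walk⇒boundaryVertex w x∉S b∈S

  cut≤numEdges : ∀ S → cut G S ≤ numEdges G
  cut≤numEdges S = length-filter _ (edges G)

  width≤numEdges : ∀ T → width G T ≤ numEdges G
  width≤numEdges (leaf v)   = cut≤numEdges (v ∷ [])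
  width≤numEdges (node l r) =
    ⊔-lub (cut≤numEdges (leaves (node l r))) (⊔-lub (width≤numEdges l) (width≤numEdges r))

  record PartialCarving (k : ℕ) : Set where
    field
      tree        : Tree n
      unique      : Unique (leaves tree)
      contractive : Contractive G tree
      height≡     : height tree ≡ k
      size≡       : length (leaves tree) ≡ suc k

  module _ (walk : ∀ u v → Walk G u v) where

    boundaryVertex : (T : Tree n) → length (leaves T) < n →
                     ∃ λ x → x ∉ leaves T × EdgeBetween G (x ∷ []) (leaves T)
    boundaryVertex T |T|<n =
      let (v , v∉T) = length<⇒∃∉ |T|<n
      in  Walk⇒boundaryVertex (walk v (leftmost T)) v∉T (leftmost∈leaves T)

    extend : ∀ {k} → PartialCarving k → suc k < n → PartialCarving (suc k)
    extend P size<n =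
      let (x , x∉T , x─T) = boundaryVertex tree (subst (_< n) (sym size≡) size<n)
      in  record
        { tree        = node (leaf x) tree
        ; unique      = ∉∧Unique⇒Unique∷ x∉T unique
        ; contractive = x─T , tt , contractive
        ; height≡     = cong suc height≡
        ; size≡       = cong suc size≡
        }
      where open PartialCarving P

    partialCarving : ∀ k → k < n → PartialCarving k
    partialCarving zero    0<n = record
      { tree = leaf (fromℕ< 0<n) ; unique = [] ∷ [] ; contractive = tt ; height≡ = refl ; size≡ = refl }
    partialCarving (suc k) k+1<n = extend (partialCarving k (<⇒≤ k+1<n)) k+1<n

proposition2 : (n : ℕ) (G : Graph n) → Connected G →
    Σ (Tree n) (λ T → IsCarving T × Contractive G T × height T ≡ n ∸ 1 × width G T ≤ numEdges G)
proposition2 zero    G (() , _)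
proposition2 (suc m) G (_ , walk) =
  tree , (Unique∧length≡⇒complete unique size≡ , unique) , contractive , height≡ , width≤numEdges G tree
  where open PartialCarving (partialCarving G walk m ≤-refl)
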